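{- Let $m,n\geq1$ and let $a_m,b_n$ be nonzero complex numbers. The resultant $R=a_m^n b_n^m\prod_{i=1}^m\prod_{j=1}^n(x_i-y_j)$, regarded as a polynomial in $\mathbb{C}[x_1,\ldots,x_m,y_1,\ldots,y_n]$, has saturated Newton polytope.
   Context: Here $R$ is the resultant of $f=\sum_{i=0}^m a_iz^i$ and $g=\sum_{i=0}^n b_iz^i$ of degrees $m,n$ with roots $x_1,\ldots,x_m$ and $y_1,\ldots,y_n$ respectively, the roots being treated as indeterminates. For a polynomial $h=\sum c_\gamma z^\gamma$, its Newton polytope is $\mathrm{conv}\{\gamma:c_\gamma\neq0\}$, and $h$ has saturated Newton polytope (SNP) if every lattice point of its Newton polytope is an exponent vector $\gamma$ with $c_\gamma\neq0$. -}

module Defs where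

open import Level using (Level; _⊔_)
open import Algebra.Bundles using (CommutativeRing)
open import Data.Nat as ℕ using (ℕ; zero; suc)
open import Data.Fin using (Fin; _↑ˡ_; _↑ʳ_)
open import Data.Integer using (+_)
open import Data.Vec using (Vec; []; _∷_; replicate; zipWith; lookup; updateAt)
import Data.Vec.Properties as VecP
open import Data.List as List using (List; []; _∷_; _++_; concatMap)
open import Data.List.Relation.Unary.All using (All)
open import Data.Product using (_×_; _,_; Σ; ∃; ∃-syntax)
open import Data.Bool using (if_then_else_)
open import Relation.Nullary using (¬_; does)
open import Relation.Binary.PropositionalEquality using (_≡_)
open import Data.Rational as ℚ using (ℚ; 0ℚ; 1ℚ)

-- Multivariate polynomials over a commutative ring, in N variables indexed by Fin N,
-- represented as finite formal sums (lists) of terms  c · z^β  with β ∈ ℕ^N.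
module Over {c ℓ : Level} (R : CommutativeRing c ℓ) where
  open CommutativeRing R

  IsField : Set (c ⊔ ℓ)
  IsField = (¬ (1# ≈ 0#)) × (∀ x → ¬ (x ≈ 0#) → ∃[ y ] (x * y ≈ 1#))

  natR : ℕ → Carrier
  natR zero = 0#
  natR (suc k) = 1# + natR k

  CharZero : Set ℓ
  CharZero = ∀ k → natR k ≈ 0# → k ≡ 0

  pow : Carrier → ℕ → Carrier
  pow a zero = 1#
  pow a (suc k) = a * pow a k

  Poly : ℕ → Set c
  Poly N = List (Carrier × Vec ℕ N)

  const : ∀ {N} → Carrier → Poly N
  const a = (a , replicate _ 0) ∷ []

  var : ∀ {N} → Fin N → Poly N
  var k = (1# , updateAt (replicate _ 0) k (λ _ → 1)) ∷ []

  _⊕_ : ∀ {N} → Poly N → Poly N → Poly N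
  p ⊕ q = p ++ q

  neg : ∀ {N} → Poly N → Poly N
  neg = List.map (λ { (a , β) → (- a , β) })

  _⊖_ : ∀ {N} → Poly N → Poly N → Poly N
  p ⊖ q = p ⊕ neg q

  _⊗_ : ∀ {N} → Poly N → Poly N → Poly N
  p ⊗ q = concatMap (λ { (a , β) → List.map (λ { (b , δ) → (a * b , zipWith ℕ._+_ β δ) }) q }) p

  one : ∀ {N} → Poly N
  one = const 1#

  prodFin : ∀ {N} k → (Fin k → Poly N) → Poly N
  prodFin zero f = one
  prodFin (suc k) f = f Fin.zero ⊗ prodFin k (λ i → f (Fin.suc i))

  coeff : ∀ {N} → Poly N → Vec ℕ N → Carrier
  coeff [] γ = 0#
  coeff ((a , β) ∷ p) γ =
    if does (VecP.≡-dec ℕ._≟_ β γ) then a + coeff p γ else coeff p γ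

  InSupport : ∀ {N} → Poly N → Vec ℕ N → Set ℓ
  InSupport h γ = ¬ (coeff h γ ≈ 0#)

  wsum : ∀ {N} → List (ℚ × Vec ℕ N) → Vec ℚ N
  wsum [] = replicate _ 0ℚ
  wsum ((λ' , β) ∷ ws) = zipWith ℚ._+_ (Data.Vec.map (λ b → λ' ℚ.* ((+ b) ℚ./ 1)) β) (wsum ws)

  wtotal : ∀ {N} → List (ℚ × Vec ℕ N) → ℚ
  wtotal [] = 0ℚ
  wtotal ((λ' , _) ∷ ws) = λ' ℚ.+ wtotal ws

  InNewtonPolytope : ∀ {N : ℕ} → Poly N → Vec ℕ N → Set ℓ
  InNewtonPolytope {N} h γ =
    Σ (List (ℚ × Vec ℕ N)) λ ws →
      All (λ { (λ' , β) → (0ℚ ℚ.≤ λ') × InSupport h β }) ws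
      × wtotal ws ≡ 1ℚ
      × wsum ws ≡ Data.Vec.map (λ g → (+ g) ℚ./ 1) γ

  HasSNP : ∀ {N} → Poly N → Set ℓ
  HasSNP h = ∀ γ → InNewtonPolytope h γ → InSupport h γ

  -- the resultant a^n b^m ∏_{i,j} (x_i − y_j) in ℂ[x_1..x_m, y_1..y_n];
  -- variable x_i is index i ↑ˡ n, variable y_j is index m ↑ʳ j (i.e. m + j)
  resultant : (m n : ℕ) → Carrier → Carrier → Poly (m ℕ.+ n)
  resultant m n a b =
    const (pow a n * pow b m) ⊗
      prodFin m (λ i → prodFin n (λ j → var (i ↑ˡ n) ⊖ var (m ↑ʳ j)))

-- Expanding ∏ᵢⱼ (xᵢ − yⱼ) by choosing one variable in every factor amounts to orienting every
-- edge of the complete bipartite graph K_{m,n}: the choice contributes (−1)^{|β|} x^α y^β, where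
-- (α, β) is the in-degree sequence of the orientation. The sign depends only on the exponent, so
-- nothing cancels: in characteristic 0 the coefficient of x^α y^β in R is a^n b^m (−1)^{|β|} times
-- the number of orientations with these in-degrees, and the support of R is the set of in-degree
-- sequences. As in the Gale–Ryser theorem, these are exactly the (α, β) with |α| + |β| = mn and
-- |S| |T| ≤ α(S) + β(T) for all S ⊆ [m], T ⊆ [n]; for sufficiency the first vertex of the first
-- side sends its out-edges to the vertices of largest remaining demand, and one recurses. These
-- conditions are linear, so they hold on the whole Newton polytope, whose lattice points are
-- therefore in the support.

{-# OPTIONS --safe #-}
module Submission where

open import Defs
open import Level using (Level)
open import Algebra.Bundles using (CommutativeRing)
open import Data.Nat using (ℕ; _≥_)
open import Relation.Nullary using (¬_)

open import Algebra.Bundles using (CommutativeMonoid)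
import Algebra.Properties.CommutativeSemigroup as CommSemigroupProperties
open import Data.Bool using (Bool; true; false; if_then_else_)
open import Data.Empty using (⊥-elim)
open import Data.Fin using (Fin; zero; suc; _↑ˡ_; _↑ʳ_)
import Data.Integer as ℤ
import Data.Integer.Properties as ℤP
open import Data.List as List using (List; []; _∷_)
import Data.List.Properties as ListP
open import Data.List.Relation.Unary.All as All using (All; []; _∷_)
import Data.List.Relation.Unary.All.Properties as AllP
open import Data.List.Relation.Unary.Any as Any using (Any; here; there)
import Data.List.Relation.Unary.Any.Properties as AnyP
open import Data.Nat as ℕ using (zero; suc; _≤_)
import Data.Nat.Coprimality as Coprime
import Data.Nat.Properties as ℕP
open import Data.Product using (Σ-syntax; ∃-syntax; _×_; _,_; proj₁; proj₂)
open import Data.Rational as ℚ using (ℚ; 0ℚ; 1ℚ; mkℚ)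
import Data.Rational.Properties as ℚP
open import Data.Unit using (⊤)
open import Data.Vec as Vec using (Vec; []; _∷_; _++_; replicate; zipWith; sum; updateAt)
import Data.Vec.Properties as VecP
open import Relation.Binary.PropositionalEquality
  using (_≡_; refl; sym; trans; cong; cong₂; subst; subst₂; module ≡-Reasoning)
open import Relation.Nullary using (does; yes; no)

private
  variable
    k m n N : ℕ

module InDegreeSequences where
  open import Data.Nat using (_+_; _*_; _∸_; _<_; z≤n; s≤s; _≤?_; _<?_)
  open CommSemigroupProperties ℕP.+-commutativeSemigroup using (interchange)

  indicator : Vec Bool n → Vec ℕ n
  indicator []          = []
  indicator (true ∷ D)  = 1 ∷ indicator D
  indicator (false ∷ D) = 0 ∷ indicator D

  trues : Vec Bool n → ℕ
  trues D = sum (indicator D)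

  falses : Vec Bool n → ℕ
  falses []          = 0
  falses (true ∷ D)  = falses D
  falses (false ∷ D) = suc (falses D)

  sumOver : Vec Bool n → Vec ℕ n → ℕ
  sumOver []          []      = 0
  sumOver (true ∷ S)  (x ∷ v) = x + sumOver S v
  sumOver (false ∷ S) (x ∷ v) = sumOver S v

  falses+trues : (D : Vec Bool n) → falses D + trues D ≡ n
  falses+trues []          = refl
  falses+trues (true ∷ D)  = trans (ℕP.+-suc (falses D) (trues D)) (cong suc (falses+trues D))
  falses+trues (false ∷ D) = cong suc (falses+trues D)

  trues-all : ∀ m → trues (replicate m true) ≡ m
  trues-all zero    = refl
  trues-all (suc m) = cong suc (trues-all m)

  trues-none : ∀ m → trues (replicate m false) ≡ 0
  trues-none zero    = refl
  trues-none (suc m) = trues-none m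

  sumOver-all : (v : Vec ℕ n) → sumOver (replicate n true) v ≡ sum v
  sumOver-all []      = refl
  sumOver-all (x ∷ v) = cong (x +_) (sumOver-all v)

  sumOver-none : (v : Vec ℕ n) → sumOver (replicate n false) v ≡ 0
  sumOver-none []      = refl
  sumOver-none (x ∷ v) = sumOver-none v

  sumOver-zipWith : (S : Vec Bool n) (u v : Vec ℕ n) →
                    sumOver S (zipWith _+_ u v) ≡ sumOver S u + sumOver S v
  sumOver-zipWith []          []      []      = refl
  sumOver-zipWith (true ∷ S)  (x ∷ u) (y ∷ v) =
    trans (cong (x + y +_) (sumOver-zipWith S u v)) (interchange x y _ _)
  sumOver-zipWith (false ∷ S) (x ∷ u) (y ∷ v) = sumOver-zipWith S u v

  sumOver-++ : (S : Vec Bool m) (T : Vec Bool n) (u : Vec ℕ m) (v : Vec ℕ n) →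
               sumOver (S ++ T) (u ++ v) ≡ sumOver S u + sumOver T v
  sumOver-++ []          T []      v = refl
  sumOver-++ (true ∷ S)  T (x ∷ u) v = trans (cong (x +_) (sumOver-++ S T u v)) (sym (ℕP.+-assoc x _ _))
  sumOver-++ (false ∷ S) T (x ∷ u) v = sumOver-++ S T u v

  sum-zipWith : (u v : Vec ℕ n) → sum (zipWith _+_ u v) ≡ sum u + sum v
  sum-zipWith u v = begin
    sum (zipWith _+_ u v)                     ≡⟨ sumOver-all (zipWith _+_ u v) ⟨
    sumOver (replicate _ true) (zipWith _+_ u v) ≡⟨ sumOver-zipWith (replicate _ true) u v ⟩
    sumOver (replicate _ true) u + sumOver (replicate _ true) v ≡⟨ cong₂ _+_ (sumOver-all u) (sumOver-all v) ⟩
    sum u + sum v                             ∎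
    where open ≡-Reasoning

  sum-replicate-0 : ∀ n → sum (replicate n 0) ≡ 0
  sum-replicate-0 zero    = refl
  sum-replicate-0 (suc n) = sum-replicate-0 n

  -- Each edge between the new vertex and T points either to that vertex or into T.
  trues≤falses+sumOver-indicator : (T D : Vec Bool n) → trues T ≤ falses D + sumOver T (indicator D)
  trues≤falses+sumOver-indicator []          []          = z≤n
  trues≤falses+sumOver-indicator (true ∷ T)  (true ∷ D)  =
    ℕP.≤-trans (s≤s (trues≤falses+sumOver-indicator T D)) (ℕP.≤-reflexive (sym (ℕP.+-suc (falses D) _)))
  trues≤falses+sumOver-indicator (true ∷ T)  (false ∷ D) = s≤s (trues≤falses+sumOver-indicator T D)
  trues≤falses+sumOver-indicator (false ∷ T) (true ∷ D)  = trues≤falses+sumOver-indicator T D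
  trues≤falses+sumOver-indicator (false ∷ T) (false ∷ D) = ℕP.m≤n⇒m≤1+n (trues≤falses+sumOver-indicator T D)

  -- InDegrees α β: α ++ β is the in-degree sequence of an orientation of the complete bipartite
  -- graph K_{m,n}, given one vertex of the first side at a time; D marks the edges at that vertex
  -- that point to the second side.
  data InDegrees : Vec ℕ m → Vec ℕ n → Set where
    []  : InDegrees [] (replicate n 0)
    _∷_ : ∀ {α : Vec ℕ m} {β : Vec ℕ n} (D : Vec Bool n) →
          InDegrees α β → InDegrees (falses D ∷ α) (zipWith _+_ (indicator D) β)

  CutConditions : Vec ℕ m → Vec ℕ n → Set
  CutConditions {m} {n} α β =
    sum α + sum β ≡ m * n × (∀ S T → trues S * trues T ≤ sumOver S α + sumOver T β)

  cut-∷ : {α : Vec ℕ m} {β : Vec ℕ n} (D : Vec Bool n) →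
          CutConditions α β → CutConditions (falses D ∷ α) (zipWith _+_ (indicator D) β)
  cut-∷ {m} {n} {α} {β} D (total , cut) = total′ , cut′
    where
    open ℕP.≤-Reasoning
    total′ : falses D + sum α + sum (zipWith _+_ (indicator D) β) ≡ n + m * n
    total′ = begin-equality
      falses D + sum α + sum (zipWith _+_ (indicator D) β)
        ≡⟨ cong (falses D + sum α +_) (sum-zipWith (indicator D) β) ⟩
      falses D + sum α + (trues D + sum β)
        ≡⟨ interchange (falses D) (sum α) (trues D) (sum β) ⟩
      falses D + trues D + (sum α + sum β)
        ≡⟨ cong₂ _+_ (falses+trues D) total ⟩
      n + m * n ∎
    cut′ : ∀ S T → trues S * trues T ≤ sumOver S (falses D ∷ α) + sumOver T (zipWith _+_ (indicator D) β)
    cut′ (true ∷ S) T = begin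
      trues T + trues S * trues T
        ≤⟨ ℕP.+-mono-≤ (trues≤falses+sumOver-indicator T D) (cut S T) ⟩
      falses D + sumOver T (indicator D) + (sumOver S α + sumOver T β)
        ≡⟨ interchange (falses D) _ (sumOver S α) _ ⟩
      falses D + sumOver S α + (sumOver T (indicator D) + sumOver T β)
        ≡⟨ cong (falses D + sumOver S α +_) (sumOver-zipWith T (indicator D) β) ⟨
      falses D + sumOver S α + sumOver T (zipWith _+_ (indicator D) β) ∎
    cut′ (false ∷ S) T = begin
      trues S * trues T
        ≤⟨ cut S T ⟩
      sumOver S α + sumOver T β
        ≤⟨ ℕP.+-monoʳ-≤ (sumOver S α) (ℕP.m≤n+m _ _) ⟩
      sumOver S α + (sumOver T (indicator D) + sumOver T β)
        ≡⟨ cong (sumOver S α +_) (sumOver-zipWith T (indicator D) β) ⟨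
      sumOver S α + sumOver T (zipWith _+_ (indicator D) β) ∎

  inDegrees⇒cut : {α : Vec ℕ m} {β : Vec ℕ n} → InDegrees α β → CutConditions α β
  inDegrees⇒cut {n = n} [] = sum-replicate-0 n , λ { [] T → z≤n }
  inDegrees⇒cut (D ∷ d)    = cut-∷ D (inDegrees⇒cut d)

  shortfall : ℕ → Vec ℕ n → ℕ
  shortfall s []      = 0
  shortfall s (b ∷ β) = s ∸ b + shortfall s β

  below : ℕ → Vec ℕ n → Vec Bool n
  below s [] = []
  below s (b ∷ β) with b <? s
  ... | yes _ = true ∷ below s β
  ... | no  _ = false ∷ below s β

  shortfall+sumOver-below : ∀ s (β : Vec ℕ n) → shortfall s β + sumOver (below s β) β ≡ s * trues (below s β)
  shortfall+sumOver-below s []      = sym (ℕP.*-zeroʳ s)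
  shortfall+sumOver-below s (b ∷ β) with b <? s
  ... | yes b<s = begin-equality
    s ∸ b + shortfall s β + (b + sumOver (below s β) β)
      ≡⟨ interchange (s ∸ b) (shortfall s β) b _ ⟩
    s ∸ b + b + (shortfall s β + sumOver (below s β) β)
      ≡⟨ cong₂ _+_ (ℕP.m∸n+n≡m (ℕP.<⇒≤ b<s)) (shortfall+sumOver-below s β) ⟩
    s + s * trues (below s β)
      ≡⟨ ℕP.*-suc s _ ⟨
    s * suc (trues (below s β)) ∎
    where open ℕP.≤-Reasoning
  ... | no b≮s =
    trans (cong (λ d → d + shortfall s β + sumOver (below s β) β) (ℕP.m≤n⇒m∸n≡0 (ℕP.≮⇒≥ b≮s)))
          (shortfall+sumOver-below s β)

  shortfall-bound : ∀ s {n} (β : Vec ℕ n) → s * n ≤ shortfall s β + sum β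
  shortfall-bound s []      = ℕP.≤-reflexive (ℕP.*-zeroʳ s)
  shortfall-bound s {suc n} (b ∷ β) = begin
    s * suc n                                   ≡⟨ ℕP.*-suc s n ⟩
    s + s * n                                   ≤⟨ ℕP.+-mono-≤ s≤s∸b+b (shortfall-bound s β) ⟩
    s ∸ b + b + (shortfall s β + sum β)         ≡⟨ interchange (s ∸ b) b (shortfall s β) (sum β) ⟩
    s ∸ b + shortfall s β + (b + sum β)         ∎
    where
    open ℕP.≤-Reasoning
    s≤s∸b+b : s ≤ s ∸ b + b
    s≤s∸b+b = ℕP.≤-trans (ℕP.m≤n+m∸n s b) (ℕP.≤-reflexive (ℕP.+-comm b (s ∸ b)))

  -- yⱼ can absorb at most βⱼ of the |S| edges from S, so at least shortfall |S| β of the edges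
  -- between S and the second side point into S.
  ShortfallConditions : Vec ℕ m → Vec ℕ n → Set
  ShortfallConditions {m} {n} α β =
    sum α + sum β ≡ m * n × (∀ S → shortfall (trues S) β ≤ sumOver S α)

  -- T = below |S| β maximises |S| |T| − β(T), and the maximum is shortfall |S| β.
  cut⇒shortfall : {α : Vec ℕ m} {β : Vec ℕ n} → CutConditions α β → ShortfallConditions α β
  cut⇒shortfall {α = α} {β} (total , cut) = total , λ S →
    let T = below (trues S) β in
    ℕP.+-cancelʳ-≤ (sumOver T β) _ _
      (subst (_≤ sumOver S α + sumOver T β) (sym (shortfall+sumOver-below (trues S) β)) (cut S T))

  atLeast : ℕ → Vec ℕ n → ℕ
  atLeast t [] = 0
  atLeast t (b ∷ β) with t ≤? b
  ... | yes _ = suc (atLeast t β)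
  ... | no  _ = atLeast t β

  atLeast-suc : ∀ t (β : Vec ℕ n) → atLeast (suc t) β ≤ atLeast t β
  atLeast-suc t []      = z≤n
  atLeast-suc t (b ∷ β) with suc t ≤? b | t ≤? b
  ... | yes _   | yes _   = s≤s (atLeast-suc t β)
  ... | yes t<b | no  t≰b = ⊥-elim (t≰b (ℕP.<⇒≤ t<b))
  ... | no  _   | yes _   = ℕP.m≤n⇒m≤1+n (atLeast-suc t β)
  ... | no  _   | no  _   = atLeast-suc t β

  atLeast-large : ∀ t (β : Vec ℕ n) → sum β < t → atLeast t β ≡ 0
  atLeast-large t []      _ = refl
  atLeast-large t (b ∷ β) β<t with t ≤? b
  ... | yes t≤b = ⊥-elim (ℕP.<⇒≱ β<t (ℕP.≤-trans t≤b (ℕP.m≤m+n b (sum β))))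
  ... | no  _   = atLeast-large t β (ℕP.≤-<-trans (ℕP.m≤n+m (sum β) b) β<t)

  shortfall-one : ∀ {n} (β : Vec ℕ n) → shortfall 1 β + atLeast 1 β ≡ n
  shortfall-one []          = refl
  shortfall-one (zero ∷ β)  = cong suc (shortfall-one β)
  shortfall-one {suc n} (suc b ∷ β) = begin-equality
    0 ∸ b + shortfall 1 β + suc (atLeast 1 β)
      ≡⟨ cong (λ d → d + shortfall 1 β + suc (atLeast 1 β)) (ℕP.0∸n≡0 b) ⟩
    shortfall 1 β + suc (atLeast 1 β)
      ≡⟨ ℕP.+-suc (shortfall 1 β) _ ⟩
    suc (shortfall 1 β + atLeast 1 β)
      ≡⟨ cong suc (shortfall-one β) ⟩
    suc n ∎
    where open ℕP.≤-Reasoning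

  antitone-crossing : (f : ℕ → ℕ) → (∀ t → f (suc t) ≤ f t) →
                      ∀ {k} M → k ≤ f 0 → f M ≤ k → ∃[ t ] f (suc t) ≤ k × k ≤ f t
  antitone-crossing f f-antitone zero    k≤f0 f0≤k = 0 , ℕP.≤-trans (f-antitone 0) f0≤k , k≤f0
  antitone-crossing f f-antitone {k} (suc M) k≤f0 fM≤k with f 1 ≤? k
  ... | yes f1≤k = 0 , f1≤k , k≤f0
  ... | no  f1≰k with antitone-crossing (λ t → f (suc t)) (λ t → f-antitone (suc t)) M
                        (ℕP.<⇒≤ (ℕP.≰⇒> f1≰k)) fM≤k
  ...   | t , f[2+t]≤k , k≤f[1+t] = suc t , f[2+t]≤k , k≤f[1+t]

  Threshold : ℕ → Vec Bool n → Vec ℕ n → Set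
  Threshold t []          []      = ⊤
  Threshold t (true ∷ D)  (b ∷ β) = t ≤ b × Threshold t D β
  Threshold t (false ∷ D) (b ∷ β) = b ≤ t × Threshold t D β

  topSelect : ℕ → ℕ → Vec ℕ n → Vec Bool n
  topSelect t r [] = []
  topSelect t r (b ∷ β) with suc t ≤? b | t ≤? b
  ... | yes _ | _    = true ∷ topSelect t r β
  ... | no  _ | no _ = false ∷ topSelect t r β
  topSelect t zero    (b ∷ β) | no _ | yes _ = false ∷ topSelect t zero β
  topSelect t (suc r) (b ∷ β) | no _ | yes _ = true ∷ topSelect t r β

  topSelect-threshold : ∀ t r (β : Vec ℕ n) → Threshold t (topSelect t r β) β
  topSelect-threshold t r [] = _
  topSelect-threshold t r (b ∷ β) with suc t ≤? b | t ≤? b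
  ... | yes t<b | _    = ℕP.<⇒≤ t<b , topSelect-threshold t r β
  ... | no  t≮b | no _ = ℕP.≤-pred (ℕP.≰⇒> t≮b) , topSelect-threshold t r β
  topSelect-threshold t zero    (b ∷ β) | no t≮b | yes _   =
    ℕP.≤-pred (ℕP.≰⇒> t≮b) , topSelect-threshold t zero β
  topSelect-threshold t (suc r) (b ∷ β) | no _   | yes t≤b = t≤b , topSelect-threshold t r β

  trues-topSelect : ∀ t r (β : Vec ℕ n) → r + atLeast (suc t) β ≤ atLeast t β →
                    trues (topSelect t r β) ≡ atLeast (suc t) β + r
  trues-topSelect t r [] bound = sym (ℕP.n≤0⇒n≡0 (ℕP.≤-trans (ℕP.m≤m+n r 0) bound))
  trues-topSelect t r (b ∷ β) bound with suc t ≤? b | t ≤? b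
  ... | yes _   | yes _   =
    cong suc (trues-topSelect t r β (ℕP.≤-pred (subst (_≤ suc (atLeast t β)) (ℕP.+-suc r _) bound)))
  ... | yes t<b | no  t≰b = ⊥-elim (t≰b (ℕP.<⇒≤ t<b))
  ... | no  _   | no  _   = trues-topSelect t r β bound
  trues-topSelect t zero    (b ∷ β) bound | no _ | yes _ = trues-topSelect t zero β (atLeast-suc t β)
  trues-topSelect t (suc r) (b ∷ β) bound | no _ | yes _ =
    trans (cong suc (trues-topSelect t r β (ℕP.≤-pred bound))) (sym (ℕP.+-suc _ r))

  threshold-subset : ∀ k (β : Vec ℕ n) → k ≤ atLeast 1 β →
                     ∃[ t ] Σ[ D ∈ Vec Bool n ] trues D ≡ k × Threshold (suc t) D β
  threshold-subset k β k≤positives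
    with antitone-crossing (λ t → atLeast (suc t) β) (λ t → atLeast-suc (suc t) β) (sum β) k≤positives
                           (subst (_≤ k) (sym (atLeast-large (suc (sum β)) β ℕP.≤-refl)) z≤n)
  ... | t , above≤k , k≤atLeast = t , topSelect (suc t) r β , size , topSelect-threshold (suc t) r β
    where
    r : ℕ
    r = k ∸ atLeast (suc (suc t)) β
    size : trues (topSelect (suc t) r β) ≡ k
    size = trans
      (trues-topSelect (suc t) r β (subst (_≤ atLeast (suc t) β) (sym (ℕP.m∸n+n≡m above≤k)) k≤atLeast))
      (ℕP.m+[n∸m]≡n above≤k)

  -- Truncated subtraction; it is only used where Threshold (suc t) D β makes the entries marked by D positive.
  decrement : Vec Bool n → Vec ℕ n → Vec ℕ n
  decrement D β = zipWith _∸_ β (indicator D)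

  indicator+decrement : ∀ {t} (D : Vec Bool n) β → Threshold (suc t) D β →
                        zipWith _+_ (indicator D) (decrement D β) ≡ β
  indicator+decrement []          []          _        = refl
  indicator+decrement (true ∷ D)  (suc b ∷ β) (_ , th) = cong (suc b ∷_) (indicator+decrement D β th)
  indicator+decrement (false ∷ D) (b ∷ β)     (_ , th) = cong (b ∷_) (indicator+decrement D β th)

  sum-decrement : ∀ {t} (D : Vec Bool n) β → Threshold (suc t) D β → sum (decrement D β) + trues D ≡ sum β
  sum-decrement D β th = begin-equality
    sum (decrement D β) + trues D                     ≡⟨ ℕP.+-comm (sum (decrement D β)) (trues D) ⟩
    trues D + sum (decrement D β)                     ≡⟨ sum-zipWith (indicator D) (decrement D β) ⟨
    sum (zipWith _+_ (indicator D) (decrement D β))   ≡⟨ cong sum (indicator+decrement D β th) ⟩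
    sum β                                             ∎
    where open ℕP.≤-Reasoning

  shortfall-decrement-above : ∀ {t s} (D : Vec Bool n) β → Threshold (suc t) D β → suc t ≤ s →
                              shortfall s (decrement D β) + falses D ≡ shortfall (suc s) β
  shortfall-decrement-above []          []          _           _   = refl
  shortfall-decrement-above {s = s} (true ∷ D) (suc b ∷ β) (_ , th) t<s =
    trans (ℕP.+-assoc (s ∸ b) _ _) (cong (s ∸ b +_) (shortfall-decrement-above D β th t<s))
  shortfall-decrement-above {s = s} (false ∷ D) (b ∷ β) (b≤1+t , th) t<s = begin-equality
    s ∸ b + shortfall s (decrement D β) + suc (falses D)   ≡⟨ ℕP.+-suc _ (falses D) ⟩
    suc (s ∸ b + shortfall s (decrement D β) + falses D)   ≡⟨ cong suc (ℕP.+-assoc (s ∸ b) _ _) ⟩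
    suc (s ∸ b) + (shortfall s (decrement D β) + falses D)
      ≡⟨ cong₂ _+_ (sym (ℕP.+-∸-assoc 1 (ℕP.≤-trans b≤1+t t<s))) (shortfall-decrement-above D β th t<s) ⟩
    suc s ∸ b + shortfall (suc s) β                       ∎
    where open ℕP.≤-Reasoning

  shortfall-decrement-below : ∀ {t s} (D : Vec Bool n) β → Threshold (suc t) D β → s ≤ t →
                              shortfall s (decrement D β) ≡ shortfall s β
  shortfall-decrement-below []          []          _                s≤t = refl
  shortfall-decrement-below {s = s} (true ∷ D) (suc b ∷ β) (s≤s t≤b , th) s≤t = cong₂ _+_
    (trans (ℕP.m≤n⇒m∸n≡0 s≤b) (sym (ℕP.m≤n⇒m∸n≡0 (ℕP.m≤n⇒m≤1+n s≤b))))
    (shortfall-decrement-below D β th s≤t)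
    where
    s≤b : s ≤ b
    s≤b = ℕP.≤-trans s≤t t≤b
  shortfall-decrement-below {s = s} (false ∷ D) (b ∷ β) (_ , th) s≤t =
    cong (s ∸ b +_) (shortfall-decrement-below D β th s≤t)

  sum≡0⇒replicate-0 : (β : Vec ℕ n) → sum β ≡ 0 → β ≡ replicate n 0
  sum≡0⇒replicate-0 []         _  = refl
  sum≡0⇒replicate-0 (zero ∷ β) eq = cong (0 ∷_) (sum≡0⇒replicate-0 β eq)

  module _ {a} (α : Vec ℕ m) (β : Vec ℕ n) (sc : ShortfallConditions (a ∷ α) β) where
    open ℕP.≤-Reasoning

    first≤n : a ≤ n
    first≤n = ℕP.+-cancelʳ-≤ (m * n) a n (begin
      a + m * n
        ≤⟨ ℕP.+-monoʳ-≤ a (ℕP.≤-trans (shortfall-bound m β) (ℕP.+-monoˡ-≤ (sum β) restShortfall)) ⟩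
      a + (sum α + sum β)      ≡⟨ ℕP.+-assoc a (sum α) (sum β) ⟨
      a + sum α + sum β        ≡⟨ proj₁ sc ⟩
      n + m * n                ∎)
      where
      restShortfall : shortfall m β ≤ sum α
      restShortfall = subst₂ _≤_ (cong (λ s → shortfall s β) (trues-all m)) (sumOver-all α)
                  (proj₂ sc (false ∷ replicate m true))

    n∸first≤atLeast1 : n ∸ a ≤ atLeast 1 β
    n∸first≤atLeast1 = begin
      n ∸ a                                  ≤⟨ ℕP.∸-monoʳ-≤ n firstShortfall ⟩
      n ∸ shortfall 1 β                      ≡⟨ cong (_∸ shortfall 1 β) (shortfall-one β) ⟨
      shortfall 1 β + atLeast 1 β ∸ shortfall 1 β ≡⟨ ℕP.m+n∸m≡n (shortfall 1 β) (atLeast 1 β) ⟩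
      atLeast 1 β                            ∎
      where
      firstShortfall : shortfall 1 β ≤ a
      firstShortfall = subst₂ _≤_ (cong (λ s → shortfall (suc s) β) (trues-none m))
                       (trans (cong (a +_) (sumOver-none α)) (ℕP.+-identityʳ a))
                       (proj₂ sc (true ∷ replicate m false))

    removeFirstVertex : ∀ {t} (D : Vec Bool n) → Threshold (suc t) D β → falses D ≡ a →
                        ShortfallConditions α (decrement D β)
    removeFirstVertex {t} D th falses≡a = total , conditions
      where
      β′ : Vec ℕ n
      β′ = decrement D β
      total : sum α + sum β′ ≡ m * n
      total = ℕP.+-cancelʳ-≡ n _ _ (begin-equality
        sum α + sum β′ + n                      ≡⟨ cong (sum α + sum β′ +_) (falses+trues D) ⟨
        sum α + sum β′ + (falses D + trues D)   ≡⟨ interchange (sum α) (sum β′) (falses D) (trues D) ⟩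
        sum α + falses D + (sum β′ + trues D)   ≡⟨ cong₂ _+_ (ℕP.+-comm (sum α) (falses D)) (sum-decrement D β th) ⟩
        falses D + sum α + sum β                ≡⟨ cong (λ x → x + sum α + sum β) falses≡a ⟩
        a + sum α + sum β                       ≡⟨ proj₁ sc ⟩
        n + m * n                               ≡⟨ ℕP.+-comm n (m * n) ⟩
        m * n + n                               ∎)
      conditions : ∀ S → shortfall (trues S) β′ ≤ sumOver S α
      conditions S with suc t ≤? trues S
      ... | yes t<s = ℕP.+-cancelʳ-≤ a _ _ (begin
        shortfall (trues S) β′ + a         ≡⟨ cong (shortfall (trues S) β′ +_) falses≡a ⟨
        shortfall (trues S) β′ + falses D  ≡⟨ shortfall-decrement-above D β th t<s ⟩
        shortfall (suc (trues S)) β        ≤⟨ proj₂ sc (true ∷ S) ⟩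
        a + sumOver S α                    ≡⟨ ℕP.+-comm a (sumOver S α) ⟩
        sumOver S α + a                    ∎)
      ... | no t≮s = begin
        shortfall (trues S) β′  ≡⟨ shortfall-decrement-below D β th (ℕP.≤-pred (ℕP.≰⇒> t≮s)) ⟩
        shortfall (trues S) β   ≤⟨ proj₂ sc (false ∷ S) ⟩
        sumOver S α             ∎

  -- The first vertex points its n ∸ a out-edges to a set D of n ∸ a vertices of largest demand βⱼ;
  -- the remaining demands decrement D β again satisfy the conditions.
  shortfall⇒inDegrees : {α : Vec ℕ m} {β : Vec ℕ n} → ShortfallConditions α β → InDegrees α β
  shortfall⇒inDegrees {α = []} {β} (total , _) = subst (InDegrees []) (sym (sum≡0⇒replicate-0 β total)) []
  shortfall⇒inDegrees {n = n} {α = a ∷ α} {β} sc with threshold-subset (n ∸ a) β (n∸first≤atLeast1 α β sc)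
  ... | t , D , size , th = subst₂ InDegrees (cong (_∷ α) falses≡a) (indicator+decrement D β th)
                              (D ∷ shortfall⇒inDegrees (removeFirstVertex α β sc D th falses≡a))
    where
    falses≡a : falses D ≡ a
    falses≡a = ℕP.+-cancelʳ-≡ (n ∸ a) (falses D) a (begin-equality
      falses D + (n ∸ a)   ≡⟨ cong (falses D +_) size ⟨
      falses D + trues D   ≡⟨ falses+trues D ⟩
      n                    ≡⟨ ℕP.m+[n∸m]≡n (first≤n α β sc) ⟨
      a + (n ∸ a)          ∎)
      where open ℕP.≤-Reasoning

  cut⇒inDegrees : {α : Vec ℕ m} {β : Vec ℕ n} → CutConditions α β → InDegrees α β
  cut⇒inDegrees cut = shortfall⇒inDegrees (cut⇒shortfall cut)

open InDegreeSequences

open CommSemigroupProperties (CommutativeMonoid.commutativeSemigroup ℚP.+-0-commutativeMonoid)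
  renaming (interchange to ℚ-interchange)

ι : ℕ → ℚ
ι n = ℤ.+ n ℚ./ 1

ι≡mkℚ : ∀ n → ι n ≡ mkℚ (ℤ.+ n) 0 (Coprime.sym (Coprime.1-coprimeTo n))
ι≡mkℚ n = ℚP.normalize-coprime (Coprime.sym (Coprime.1-coprimeTo n))

ι-+ : ∀ x y → ι (x ℕ.+ y) ≡ ι x ℚ.+ ι y
ι-+ x y rewrite ι≡mkℚ x | ι≡mkℚ y =
  ℚP./-cong (cong₂ ℤ._+_ (sym (ℤP.*-identityʳ (ℤ.+ x))) (sym (ℤP.*-identityʳ (ℤ.+ y)))) refl

ι-mono-≤ : ∀ {x y} → x ≤ y → ι x ℚ.≤ ι y
ι-mono-≤ {x} {y} x≤y rewrite ι≡mkℚ x | ι≡mkℚ y =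
  ℚ.*≤* (subst₂ ℤ._≤_ (sym (ℤP.*-identityʳ (ℤ.+ x))) (sym (ℤP.*-identityʳ (ℤ.+ y))) (ℤ.+≤+ x≤y))

ι-cancel-≤ : ∀ {x y} → ι x ℚ.≤ ι y → x ≤ y
ι-cancel-≤ {x} {y} ιx≤ιy rewrite ι≡mkℚ x | ι≡mkℚ y with ιx≤ιy
... | ℚ.*≤* x*1≤y*1 with subst₂ ℤ._≤_ (ℤP.*-identityʳ (ℤ.+ x)) (ℤP.*-identityʳ (ℤ.+ y)) x*1≤y*1
...   | ℤ.+≤+ x≤y = x≤y

sumOverℚ : Vec Bool n → Vec ℚ n → ℚ
sumOverℚ []          []      = 0ℚ
sumOverℚ (true ∷ S)  (x ∷ v) = x ℚ.+ sumOverℚ S v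
sumOverℚ (false ∷ S) (x ∷ v) = sumOverℚ S v

sumOverℚ-zipWith : (S : Vec Bool n) (u v : Vec ℚ n) →
                   sumOverℚ S (zipWith ℚ._+_ u v) ≡ sumOverℚ S u ℚ.+ sumOverℚ S v
sumOverℚ-zipWith []          []      []      = refl
sumOverℚ-zipWith (true ∷ S)  (x ∷ u) (y ∷ v) =
  trans (cong (x ℚ.+ y ℚ.+_) (sumOverℚ-zipWith S u v)) (ℚ-interchange x y _ _)
sumOverℚ-zipWith (false ∷ S) (x ∷ u) (y ∷ v) = sumOverℚ-zipWith S u v

sumOverℚ-zero : (S : Vec Bool n) → sumOverℚ S (replicate n 0ℚ) ≡ 0ℚ
sumOverℚ-zero []          = refl
sumOverℚ-zero (true ∷ S)  = trans (ℚP.+-identityˡ _) (sumOverℚ-zero S)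
sumOverℚ-zero (false ∷ S) = sumOverℚ-zero S

sumOverℚ-scale : (S : Vec Bool n) (l : ℚ) (v : Vec ℕ n) →
                 sumOverℚ S (Vec.map (λ x → l ℚ.* ι x) v) ≡ l ℚ.* ι (sumOver S v)
sumOverℚ-scale []          l []      = sym (ℚP.*-zeroʳ l)
sumOverℚ-scale (true ∷ S)  l (x ∷ v) = begin
  l ℚ.* ι x ℚ.+ sumOverℚ S (Vec.map (λ x → l ℚ.* ι x) v)
    ≡⟨ cong (l ℚ.* ι x ℚ.+_) (sumOverℚ-scale S l v) ⟩
  l ℚ.* ι x ℚ.+ l ℚ.* ι (sumOver S v)                      ≡⟨ ℚP.*-distribˡ-+ l (ι x) _ ⟨
  l ℚ.* (ι x ℚ.+ ι (sumOver S v))                          ≡⟨ cong (l ℚ.*_) (ι-+ x _) ⟨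
  l ℚ.* ι (x ℕ.+ sumOver S v)                                ∎
  where open ≡-Reasoning
sumOverℚ-scale (false ∷ S) l (x ∷ v) = sumOverℚ-scale S l v

sumOverℚ-ι : (S : Vec Bool n) (v : Vec ℕ n) → sumOverℚ S (Vec.map ι v) ≡ ι (sumOver S v)
sumOverℚ-ι []          []      = refl
sumOverℚ-ι (true ∷ S)  (x ∷ v) = trans (cong (ι x ℚ.+_) (sumOverℚ-ι S v)) (sym (ι-+ x _))
sumOverℚ-ι (false ∷ S) (x ∷ v) = sumOverℚ-ι S v

weighted : (Vec ℕ N → ℕ) → List (ℚ × Vec ℕ N) → ℚ
weighted f []             = 0ℚ
weighted f ((l , β) ∷ ws) = l ℚ.* ι (f β) ℚ.+ weighted f ws

weighted-mono : {f g : Vec ℕ N → ℕ} (ws : List (ℚ × Vec ℕ N)) →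
                All (λ (l , β) → 0ℚ ℚ.≤ l × f β ≤ g β) ws → weighted f ws ℚ.≤ weighted g ws
weighted-mono []             []                = ℚP.≤-refl
weighted-mono ((l , β) ∷ ws) ((l≥0 , f≤g) ∷ hs) =
  ℚP.+-mono-≤ (ℚP.*-monoˡ-≤-nonNeg l {{ℚ.nonNegative l≥0}} (ι-mono-≤ f≤g)) (weighted-mono ws hs)

zeros-+ : (v : Vec ℕ n) → zipWith ℕ._+_ (replicate n 0) v ≡ v
zeros-+ = VecP.zipWith-identityˡ ℕP.+-identityˡ

replicate-++ : ∀ {a} {A : Set a} m n (x : A) → replicate (m ℕ.+ n) x ≡ replicate m x ++ replicate n x
replicate-++ zero    n x = refl
replicate-++ (suc m) n x = cong (x ∷_) (replicate-++ m n x)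

unit : Fin n → Vec ℕ n
unit j = updateAt (replicate _ 0) j (λ _ → 1)

unit-↑ʳ-+ : ∀ m (j : Fin n) v →
            zipWith ℕ._+_ (unit (m ↑ʳ j)) (replicate m 0 ++ v) ≡ replicate m 0 ++ zipWith ℕ._+_ (unit j) v
unit-↑ʳ-+ zero    j v = refl
unit-↑ʳ-+ (suc m) j v = cong (0 ∷_) (unit-↑ʳ-+ m j v)

scatter : (Fin k → Fin n) → Vec Bool k → Vec ℕ n
scatter f []          = replicate _ 0
scatter f (true ∷ u)  = zipWith ℕ._+_ (unit (f zero)) (scatter (λ j → f (suc j)) u)
scatter f (false ∷ u) = scatter (λ j → f (suc j)) u

scatter-suc : (f : Fin k → Fin n) (u : Vec Bool k) → scatter (λ j → suc (f j)) u ≡ 0 ∷ scatter f u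
scatter-suc f []          = refl
scatter-suc f (true ∷ u)  = cong (zipWith ℕ._+_ (0 ∷ unit (f zero))) (scatter-suc (λ j → f (suc j)) u)
scatter-suc f (false ∷ u) = scatter-suc (λ j → f (suc j)) u

scatter-id : (u : Vec Bool n) → scatter (λ j → j) u ≡ indicator u
scatter-id []          = refl
scatter-id (true ∷ u)  =
  trans (cong (zipWith ℕ._+_ (unit zero)) (scatter-suc (λ j → j) u)) (cong (1 ∷_) (trans (zeros-+ _) (scatter-id u)))
scatter-id (false ∷ u) = trans (scatter-suc (λ j → j) u) (cong (0 ∷_) (scatter-id u))

-- The exponent of the term of row m f that picks y_{f j} in the factors j marked by u and x₀ in the others.
rowExponent : ∀ m → (Fin k → Fin n) → Vec Bool k → Vec ℕ (suc m ℕ.+ n)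
rowExponent m f u = (falses u ∷ replicate m 0) ++ scatter f u

rowExponent-false : ∀ m (f : Fin (suc k) → Fin n) u →
                    zipWith ℕ._+_ (unit zero) (rowExponent m (λ j → f (suc j)) u) ≡ rowExponent m f (false ∷ u)
rowExponent-false m f u = cong (suc (falses u) ∷_) (zeros-+ _)

rowExponent-true : ∀ m (f : Fin (suc k) → Fin n) u →
                   zipWith ℕ._+_ (unit (suc m ↑ʳ f zero)) (rowExponent m (λ j → f (suc j)) u) ≡
                   rowExponent m f (true ∷ u)
rowExponent-true m f u = cong (falses u ∷_) (unit-↑ʳ-+ m (f zero) _)

rowExponent-+ : ∀ m (D : Vec Bool n) (α : Vec ℕ m) (β : Vec ℕ n) →
                zipWith ℕ._+_ (rowExponent m (λ j → j) D) (0 ∷ α ++ β) ≡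
                (falses D ∷ α) ++ zipWith ℕ._+_ (indicator D) β
rowExponent-+ m D α β =
  trans (VecP.zipWith-++ ℕ._+_ (falses D ∷ replicate m 0) (scatter (λ j → j) D) (0 ∷ α) β)
        (cong₂ _++_ (cong₂ _∷_ (ℕP.+-identityʳ (falses D)) (zeros-+ α))
                    (cong (λ v → zipWith ℕ._+_ v β) (scatter-id D)))

module ResultantSupport {c ℓ : Level} (K : CommutativeRing c ℓ) where
  open CommutativeRing K hiding (zero) renaming (refl to ≈-refl; sym to ≈-sym; trans to ≈-trans)
  open Over K

  weighted-const : ∀ {N} C (ws : List (ℚ × Vec ℕ N)) → wtotal ws ≡ 1ℚ → weighted (λ _ → C) ws ≡ ι C
  weighted-const {N} C ws total = trans (scaled ws) (trans (cong (ι C ℚ.*_) total) (ℚP.*-identityʳ (ι C)))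
    where
    scaled : (ws : List (ℚ × Vec ℕ N)) → weighted (λ _ → C) ws ≡ ι C ℚ.* wtotal ws
    scaled []             = sym (ℚP.*-zeroʳ (ι C))
    scaled ((l , β) ∷ ws) =
      trans (cong₂ ℚ._+_ (ℚP.*-comm l (ι C)) (scaled ws)) (sym (ℚP.*-distribˡ-+ (ι C) l (wtotal ws)))

  weighted-sumOver : ∀ {N} (ws : List (ℚ × Vec ℕ N)) {γ} → wsum ws ≡ Vec.map ι γ →
                     ∀ S → weighted (sumOver S) ws ≡ ι (sumOver S γ)
  weighted-sumOver {N} ws {γ} mean S = begin
    weighted (sumOver S) ws    ≡⟨ sumOverℚ-wsum ws ⟨
    sumOverℚ S (wsum ws)       ≡⟨ cong (sumOverℚ S) mean ⟩
    sumOverℚ S (Vec.map ι γ)   ≡⟨ sumOverℚ-ι S γ ⟩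
    ι (sumOver S γ)            ∎
    where
    open ≡-Reasoning
    sumOverℚ-wsum : (ws : List (ℚ × Vec ℕ N)) → sumOverℚ S (wsum ws) ≡ weighted (sumOver S) ws
    sumOverℚ-wsum []             = sumOverℚ-zero S
    sumOverℚ-wsum ((l , β) ∷ ws) =
      trans (sumOverℚ-zipWith S _ (wsum ws)) (cong₂ ℚ._+_ (sumOverℚ-scale S l β) (sumOverℚ-wsum ws))

  newton-lower : (h : Poly N) {γ : Vec ℕ N} → InNewtonPolytope h γ → ∀ S C →
                 (∀ β → InSupport h β → C ≤ sumOver S β) → C ≤ sumOver S γ
  newton-lower h {γ} (ws , weights , total , mean) S C bound = ι-cancel-≤ (begin
    ι C                      ≡⟨ weighted-const C ws total ⟨
    weighted (λ _ → C) ws    ≤⟨ weighted-mono ws (All.map (λ (l≥0 , β∈h) → l≥0 , bound _ β∈h) weights) ⟩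
    weighted (sumOver S) ws  ≡⟨ weighted-sumOver ws mean S ⟩
    ι (sumOver S γ)          ∎)
    where open ℚP.≤-Reasoning

  newton-upper : (h : Poly N) {γ : Vec ℕ N} → InNewtonPolytope h γ → ∀ S C →
                 (∀ β → InSupport h β → sumOver S β ≤ C) → sumOver S γ ≤ C
  newton-upper h {γ} (ws , weights , total , mean) S C bound = ι-cancel-≤ (begin
    ι (sumOver S γ)          ≡⟨ weighted-sumOver ws mean S ⟨
    weighted (sumOver S) ws  ≤⟨ weighted-mono ws (All.map (λ (l≥0 , β∈h) → l≥0 , bound _ β∈h) weights) ⟩
    weighted (λ _ → C) ws    ≡⟨ weighted-const C ws total ⟩
    ι C                      ∎)
    where open ℚP.≤-Reasoning

  cut-newton : (h : Poly (m ℕ.+ n)) → (∀ α β → InSupport h (α ++ β) → CutConditions α β) →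
               ∀ {α β} → InNewtonPolytope h (α ++ β) → CutConditions α β
  cut-newton {m} {n} h support-cut {α} {β} γ∈N = total , cut
    where
    all : Vec Bool (m ℕ.+ n)
    all = replicate (m ℕ.+ n) true

    sumOver-all-++ : (α : Vec ℕ m) (β : Vec ℕ n) → sumOver all (α ++ β) ≡ sum α ℕ.+ sum β
    sumOver-all-++ α β = trans (sumOver-all (α ++ β)) (VecP.sum-++ α)

    onSplit : ∀ {p} {P : Vec ℕ (m ℕ.+ n) → Set p} → (∀ α β → P (α ++ β)) → ∀ γ → P γ
    onSplit f γ with Vec.splitAt m γ
    ... | α , β , refl = f α β

    total : sum α ℕ.+ sum β ≡ m ℕ.* n
    total = subst (_≡ m ℕ.* n) (sumOver-all-++ α β) (ℕP.≤-antisym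
      (newton-upper h γ∈N all (m ℕ.* n) (onSplit λ α β β∈h →
        ℕP.≤-reflexive (trans (sumOver-all-++ α β) (proj₁ (support-cut α β β∈h)))))
      (newton-lower h γ∈N all (m ℕ.* n) (onSplit λ α β β∈h →
        ℕP.≤-reflexive (sym (trans (sumOver-all-++ α β) (proj₁ (support-cut α β β∈h)))))))

    cut : ∀ S T → trues S ℕ.* trues T ≤ sumOver S α ℕ.+ sumOver T β
    cut S T = subst (trues S ℕ.* trues T ≤_) (sumOver-++ S T α β)
      (newton-lower h γ∈N (S ++ T) _ (onSplit λ α β β∈h →
        subst (trues S ℕ.* trues T ≤_) (sym (sumOver-++ S T α β)) (proj₂ (support-cut α β β∈h) S T)))

  Term : ℕ → Set c
  Term N = Carrier × Vec ℕ N

  _⊙_ : Term N → Term N → Term N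
  (a , β) ⊙ (b , δ) = a * b , zipWith ℕ._+_ β δ

  Occurs : Poly N → Vec ℕ N → Set c
  Occurs p γ = Any (λ t → proj₂ t ≡ γ) p

  ⊗-all : ∀ {p q r} {P : Term N → Set p} {Q : Term N → Set q} {R : Term N → Set r} {ps qs : Poly N} →
          All P ps → All Q qs → (∀ {s t} → P s → Q t → R (s ⊙ t)) → All R (ps ⊗ qs)
  ⊗-all []         Qqs f = []
  ⊗-all (Ps ∷ Pps) Qqs f = AllP.++⁺ (AllP.map⁺ (All.map (f Ps) Qqs)) (⊗-all Pps Qqs f)

  ⊗-occurs : ∀ (ps qs : Poly N) {β δ} → Occurs ps β → Occurs qs δ → Occurs (ps ⊗ qs) (zipWith ℕ._+_ β δ)
  ⊗-occurs ((a , β) ∷ ps) qs (here refl)  δ∈qs =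
    AnyP.++⁺ˡ (AnyP.map⁺ (Any.map (cong (zipWith ℕ._+_ β)) δ∈qs))
  ⊗-occurs (_ ∷ ps)       qs (there β∈ps) δ∈qs = AnyP.++⁺ʳ _ (⊗-occurs ps qs β∈ps δ∈qs)

  support⇒occurs : (p : Poly N) {γ : Vec ℕ N} → InSupport p γ → Occurs p γ
  support⇒occurs []            γ∈p = ⊥-elim (γ∈p ≈-refl)
  support⇒occurs ((a , β) ∷ p) {γ} γ∈p with VecP.≡-dec ℕ._≟_ β γ
  ... | yes β≡γ = here β≡γ
  ... | no  _   = there (support⇒occurs p γ∈p)

  multiplicity : Poly N → Vec ℕ N → ℕ
  multiplicity []            γ = 0
  multiplicity ((a , β) ∷ p) γ =
    if does (VecP.≡-dec ℕ._≟_ β γ) then suc (multiplicity p γ) else multiplicity p γ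

  occurs⇒multiplicity>0 : (p : Poly N) {γ : Vec ℕ N} → Occurs p γ → 0 ℕ.< multiplicity p γ
  occurs⇒multiplicity>0 ((a , β) ∷ p) {γ} γ∈p with VecP.≡-dec ℕ._≟_ β γ | γ∈p
  ... | yes _   | _          = ℕ.s≤s ℕ.z≤n
  ... | no  β≢γ | here β≡γ   = ⊥-elim (β≢γ β≡γ)
  ... | no  _   | there γ∈p′ = occurs⇒multiplicity>0 p γ∈p′

  coeff-uniform : (p : Poly N) {γ : Vec ℕ N} {C : Carrier} → All (λ (a , β) → β ≡ γ → a ≈ C) p →
                  coeff p γ ≈ natR (multiplicity p γ) * C
  coeff-uniform []            {C = C} []             = ≈-sym (zeroˡ C)
  coeff-uniform ((a , β) ∷ p) {γ} {C} (a≈C ∷ rest) with VecP.≡-dec ℕ._≟_ β γ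
  ... | yes β≡γ = begin
    a + coeff p γ                           ≈⟨ +-cong (a≈C β≡γ) (coeff-uniform p rest) ⟩
    C + natR (multiplicity p γ) * C         ≈⟨ +-congʳ (*-identityˡ C) ⟨
    1# * C + natR (multiplicity p γ) * C    ≈⟨ distribʳ C 1# _ ⟨
    (1# + natR (multiplicity p γ)) * C      ∎
    where open import Relation.Binary.Reasoning.Setoid setoid
  ... | no  _   = coeff-uniform p rest

  sign : ℕ → Carrier
  sign = pow (- 1#)

  pow-+ : ∀ x i j → pow x (i ℕ.+ j) ≈ pow x i * pow x j
  pow-+ x zero    j = ≈-sym (*-identityˡ _)
  pow-+ x (suc i) j = ≈-trans (*-congˡ (pow-+ x i j)) (≈-sym (*-assoc _ _ _))

  weaken : Poly N → Poly (suc N)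
  weaken = List.map (λ (a , β) → a , 0 ∷ β)

  weaken-⊗ : (p q : Poly N) → weaken (p ⊗ q) ≡ weaken p ⊗ weaken q
  weaken-⊗ []             q = refl
  weaken-⊗ ((a , β) ∷ p) q = trans (ListP.map-++ _ (List.map ((a , β) ⊙_) q) (p ⊗ q))
    (cong₂ List._++_ (trans (sym (ListP.map-∘ q)) (ListP.map-∘ q)) (weaken-⊗ p q))
    -- weakening after multiplying by (a , β) is, definitionally, multiplying by (a , 0 ∷ β) after weakening

  prodFin-cong : ∀ k {f g : Fin k → Poly N} → (∀ i → f i ≡ g i) → prodFin k f ≡ prodFin k g
  prodFin-cong zero    f≡g = refl
  prodFin-cong (suc k) f≡g = cong₂ _⊗_ (f≡g zero) (prodFin-cong k (λ i → f≡g (suc i)))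

  weaken-prodFin : ∀ k (f : Fin k → Poly N) → weaken (prodFin k f) ≡ prodFin k (λ i → weaken (f i))
  weaken-prodFin zero    f = refl
  weaken-prodFin (suc k) f = trans (weaken-⊗ (f zero) _) (cong (weaken (f zero) ⊗_) (weaken-prodFin k _))

  differences : ∀ m n → Poly (m ℕ.+ n)
  differences m n = prodFin m (λ i → prodFin n (λ j → var (i ↑ˡ n) ⊖ var (m ↑ʳ j)))

  row : ∀ m → (Fin k → Fin n) → Poly (suc m ℕ.+ n)
  row {k} m f = prodFin k (λ j → var zero ⊖ var (suc m ↑ʳ f j))

  differences-suc : ∀ m n → differences (suc m) n ≡ row m (λ j → j) ⊗ weaken (differences m n)
  differences-suc m n = cong (row m (λ j → j) ⊗_)
    (sym (trans (weaken-prodFin m _) (prodFin-cong m (λ i → weaken-prodFin n _))))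

  RowTerm : ∀ m → (Fin k → Fin n) → Term (suc m ℕ.+ n) → Set ℓ
  RowTerm m f (a , γ) = Σ[ u ∈ Vec Bool _ ] γ ≡ rowExponent m f u × a ≈ sign (trues u)

  row-terms : ∀ m {n k} (f : Fin k → Fin n) → All (RowTerm m f) (row m f)
  row-terms m {n} {zero}  f = ([] , replicate-++ (suc m) n 0 , ≈-refl) ∷ []
  row-terms m {k = suc k} f =
    AllP.++⁺ (AllP.map⁺ (All.map x-factor IH)) (AllP.++⁺ (AllP.map⁺ (All.map y-factor IH)) [])
    where
    IH : All (RowTerm m (λ j → f (suc j))) (row m (λ j → f (suc j)))
    IH = row-terms m (λ j → f (suc j))
    x-factor : ∀ {t} → RowTerm m (λ j → f (suc j)) t → RowTerm m f ((1# , unit zero) ⊙ t)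
    x-factor (u , refl , a≈) = false ∷ u , rowExponent-false m f u , ≈-trans (*-identityˡ _) a≈
    y-factor : ∀ {t} → RowTerm m (λ j → f (suc j)) t → RowTerm m f ((- 1# , unit (suc m ↑ʳ f zero)) ⊙ t)
    y-factor (u , refl , a≈) = true ∷ u , rowExponent-true m f u , *-congˡ a≈

  row-occurs : ∀ m {n k} (f : Fin k → Fin n) u → Occurs (row m f) (rowExponent m f u)
  row-occurs m {n} f []          = here (replicate-++ (suc m) n 0)
  row-occurs m {k = suc k} f (false ∷ u) = subst (Occurs (row m f)) (rowExponent-false m f u)
    (⊗-occurs (var zero ⊖ var (suc m ↑ʳ f zero)) _ (here refl) (row-occurs m (λ j → f (suc j)) u))
  row-occurs m {k = suc k} f (true ∷ u)  = subst (Occurs (row m f)) (rowExponent-true m f u)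
    (⊗-occurs (var zero ⊖ var (suc m ↑ʳ f zero)) _ (there (here refl)) (row-occurs m (λ j → f (suc j)) u))

  SignedTerm : ∀ m n → Carrier → Term (m ℕ.+ n) → Set ℓ
  SignedTerm m n A (a , γ) =
    Σ[ α ∈ Vec ℕ m ] Σ[ β ∈ Vec ℕ n ] γ ≡ α ++ β × InDegrees α β × a ≈ A * sign (sum β)

  weaken-all : ∀ {p} {P : Term N → Set p} {q : Poly N} → All P q →
               All (λ (a , δ) → Σ[ γ ∈ Vec ℕ N ] δ ≡ 0 ∷ γ × P (a , γ)) (weaken q)
  weaken-all Pq = AllP.map⁺ (All.map (λ Pt → _ , refl , Pt) Pq)

  differences-terms : ∀ m n → All (SignedTerm m n 1#) (differences m n)
  differences-terms zero    n = ([] , replicate n 0 , refl , [] , one≈) ∷ []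
    where
    one≈ : 1# ≈ 1# * sign (sum (replicate n 0))
    one≈ = ≈-sym (≈-trans (*-identityˡ _) (reflexive (cong sign (sum-replicate-0 n))))
  differences-terms (suc m) n = subst (All (SignedTerm (suc m) n 1#)) (sym (differences-suc m n))
    (⊗-all (row-terms m (λ j → j)) (weaken-all (differences-terms m n)) step)
    where
    step : ∀ {s t} → RowTerm m (λ j → j) s → (Σ[ γ ∈ _ ] proj₂ t ≡ 0 ∷ γ × SignedTerm m n 1# (proj₁ t , γ)) →
           SignedTerm (suc m) n 1# (s ⊙ t)
    step {a , _} {b , _} (D , refl , a≈) (_ , refl , α , β , refl , d , b≈) =
      falses D ∷ α , zipWith ℕ._+_ (indicator D) β , rowExponent-+ m D α β , D ∷ d , coefficient
      where
      open import Relation.Binary.Reasoning.Setoid setoid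
      coefficient : a * b ≈ 1# * sign (sum (zipWith ℕ._+_ (indicator D) β))
      coefficient = begin
        a * b                                         ≈⟨ *-cong a≈ (≈-trans b≈ (*-identityˡ _)) ⟩
        sign (trues D) * sign (sum β)                 ≈⟨ pow-+ (- 1#) (trues D) (sum β) ⟨
        sign (trues D ℕ.+ sum β)                      ≡⟨ cong sign (sum-zipWith (indicator D) β) ⟨
        sign (sum (zipWith ℕ._+_ (indicator D) β))    ≈⟨ *-identityˡ _ ⟨
        1# * sign (sum (zipWith ℕ._+_ (indicator D) β)) ∎

  inDegrees⇒occurs : {α : Vec ℕ m} {β : Vec ℕ n} → InDegrees α β → Occurs (differences m n) (α ++ β)
  inDegrees⇒occurs []                         = here refl
  inDegrees⇒occurs {suc m} {n} (_∷_ {α = α} {β} D d) =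
    subst (λ p → Occurs p _) (sym (differences-suc m n))
      (subst (Occurs _) (rowExponent-+ m D α β)
        (⊗-occurs (row m (λ j → j)) (weaken (differences m n)) (row-occurs m (λ j → j) D)
          (AnyP.map⁺ (Any.map (cong (0 ∷_)) (inDegrees⇒occurs d)))))

  signedTerm-at : ∀ {m n A t} {α : Vec ℕ m} {β : Vec ℕ n} → SignedTerm m n A t → proj₂ t ≡ α ++ β →
                  InDegrees α β × proj₁ t ≈ A * sign (sum β)
  signedTerm-at {α = α} (α′ , β′ , refl , d , a≈) eq with VecP.++-injective α′ α eq
  ... | refl , refl = d , a≈

  module _ (m n : ℕ) (a b : Carrier) where
    leadingCoefficient : Carrier
    leadingCoefficient = pow a n * pow b m

    resultant-terms : All (SignedTerm m n leadingCoefficient) (resultant m n a b)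
    resultant-terms = ⊗-all {P = _≡ (leadingCoefficient , replicate _ 0)} (refl ∷ []) (differences-terms m n) step
      where
      step : ∀ {s t} → s ≡ (leadingCoefficient , replicate _ 0) → SignedTerm m n 1# t →
             SignedTerm m n leadingCoefficient (s ⊙ t)
      step refl (α , β , refl , d , c≈) =
        α , β , zeros-+ (α ++ β) , d , *-congˡ (≈-trans c≈ (*-identityˡ _))

    inDegrees⇒resultant-occurs : {α : Vec ℕ m} {β : Vec ℕ n} → InDegrees α β →
                                 Occurs (resultant m n a b) (α ++ β)
    inDegrees⇒resultant-occurs {α} {β} d = subst (Occurs _) (zeros-+ (α ++ β))
      (⊗-occurs (const leadingCoefficient) (differences m n) (here refl) (inDegrees⇒occurs d))

    resultant-support-cut : (α : Vec ℕ m) (β : Vec ℕ n) → InSupport (resultant m n a b) (α ++ β) →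
                            CutConditions α β
    resultant-support-cut α β γ∈R with All.lookupAny resultant-terms (support⇒occurs (resultant m n a b) γ∈R)
    ... | signed , exponent = inDegrees⇒cut (proj₁ (signedTerm-at signed exponent))

    resultant-uniform : (α : Vec ℕ m) (β : Vec ℕ n) →
                        All (λ (c , γ) → γ ≡ α ++ β → c ≈ leadingCoefficient * sign (sum β)) (resultant m n a b)
    resultant-uniform α β =
      All.map (λ signed exponent → proj₂ (signedTerm-at {α = α} signed exponent)) resultant-terms

  natR-≉0 : CharZero → 0 ℕ.< k → natR k ≉ 0#
  natR-≉0 {k} charZero k>0 k≈0 = ℕP.<⇒≢ k>0 (sym (charZero k k≈0))

  module InField (isField : IsField) where
    *-≉0 : ∀ {x y} → x ≉ 0# → y ≉ 0# → x * y ≉ 0#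
    *-≉0 {x} {y} x≉0 y≉0 xy≈0 with proj₂ isField x x≉0
    ... | x⁻¹ , xx⁻¹≈1 = y≉0 (begin
      y              ≈⟨ *-identityˡ y ⟨
      1# * y         ≈⟨ *-congʳ xx⁻¹≈1 ⟨
      x * x⁻¹ * y    ≈⟨ *-congʳ (*-comm x x⁻¹) ⟩
      x⁻¹ * x * y    ≈⟨ *-assoc x⁻¹ x y ⟩
      x⁻¹ * (x * y)  ≈⟨ *-congˡ xy≈0 ⟩
      x⁻¹ * 0#       ≈⟨ zeroʳ x⁻¹ ⟩
      0#             ∎)
      where open import Relation.Binary.Reasoning.Setoid setoid

    pow-≉0 : ∀ {x} → x ≉ 0# → ∀ k → pow x k ≉ 0#
    pow-≉0 x≉0 zero    = proj₁ isField
    pow-≉0 x≉0 (suc k) = *-≉0 x≉0 (pow-≉0 x≉0 k)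

    -1≉0 : - 1# ≉ 0#
    -1≉0 -1≈0 = proj₁ isField (begin
      1#          ≈⟨ +-identityʳ 1# ⟨
      1# + 0#     ≈⟨ +-congˡ -1≈0 ⟨
      1# + - 1#   ≈⟨ -‿inverseʳ 1# ⟩
      0#          ∎)
      where open import Relation.Binary.Reasoning.Setoid setoid

    uniform⇒support : CharZero → (p : Poly N) {γ : Vec ℕ N} {C : Carrier} → C ≉ 0# → Occurs p γ →
                      All (λ (a , β) → β ≡ γ → a ≈ C) p → InSupport p γ
    uniform⇒support charZero p C≉0 γ∈p uniform coeff≈0 =
      *-≉0 (natR-≉0 charZero (occurs⇒multiplicity>0 p γ∈p)) C≉0
           (≈-trans (≈-sym (coeff-uniform p uniform)) coeff≈0)

theorem2p20 : ∀ {c ℓ : Level} (K : CommutativeRing c ℓ) → Over.IsField K → Over.CharZero K →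
    (m n : ℕ) → m ≥ 1 → n ≥ 1 →
    (a b : CommutativeRing.Carrier K) →
    ¬ (CommutativeRing._≈_ K a (CommutativeRing.0# K)) →
    ¬ (CommutativeRing._≈_ K b (CommutativeRing.0# K)) →
    Over.HasSNP K (Over.resultant K m n a b)
theorem2p20 K isField charZero m n _ _ a b a≉0 b≉0 γ γ∈N with Vec.splitAt m γ
... | α , β , refl = uniform⇒support charZero R coefficient≉0 occurs (resultant-uniform m n a b α β)
  where
  open CommutativeRing K using (_*_; _≉_; 0#)
  open Over K using (Poly; resultant)
  open ResultantSupport K
  open InField isField
  R : Poly (m ℕ.+ n)
  R = resultant m n a b
  cut : CutConditions α β
  cut = cut-newton R (resultant-support-cut m n a b) γ∈N
  occurs : Occurs R (α ++ β)
  occurs = inDegrees⇒resultant-occurs m n a b (cut⇒inDegrees cut)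
  coefficient≉0 : leadingCoefficient m n a b * sign (sum β) ≉ 0#
  coefficient≉0 = *-≉0 (*-≉0 (pow-≉0 a≉0 n) (pow-≉0 b≉0 m)) (pow-≉0 -1≉0 (sum β))
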